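{- For every positive integer $n$, the number of isomorphism classes of semisymmetric idempotent Latin squares of order $n$ equals the number of isomorphism classes of semisymmetric unipotent Latin squares of order $n+1$.
   Context: A Latin square of order $n$ is an $n\times n$ array with rows, columns and symbols all indexed by $\{1,\dots,n\}$, each row and column containing every symbol exactly once; equivalently, a set of $n^2$ triples (row, column, symbol) such that distinct triples agree in at most one coordinate. It is semisymmetric if whenever $(a,b,c)$ is one of its triples, so is $(b,c,a)$. It is idempotent if cell $(i,i)$ contains symbol $i$ for every $i$, and unipotent if all cells on the main diagonal contain the same symbol. For $\alpha\in\mathcal{S}_n$, the isomorphism $(\alpha,\alpha,\alpha)$ maps each triple $(r,c,s)$ to $(r^\alpha,c^\alpha,s^\alpha)$; two Latin squares are isomorphic if one is mapped to the other by some isomorphism. -}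

module Defs where

open import Data.Nat using (ℕ; suc)
open import Data.Fin using (Fin)
open import Data.Product using (Σ; ∃; _×_; _,_)
open import Relation.Binary.PropositionalEquality using (_≡_)
open import Relation.Nullary using (¬_)
open import Function.Bundles using (_↔_; Inverse)
open import Function.Definitions using (Injective)

-- A Latin square of order n, given as its set of n² triples (r , c , cell r c):
-- one triple per cell, and distinct triples agree in at most one coordinate,
-- i.e. two triples sharing row and symbol (resp. column and symbol) coincide.
record LatinSquare (n : ℕ) : Set where
  field
    cell   : Fin n → Fin n → Fin n
    rowInj : ∀ r → Injective _≡_ _≡_ (cell r)
    colInj : ∀ c → Injective _≡_ _≡_ (λ r → cell r c)
open LatinSquare public

-- (a,b,c) a triple ⇒ (b,c,a) a triple.
Semisymmetric : ∀ {n} → LatinSquare n → Set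
Semisymmetric L = ∀ a b → cell L b (cell L a b) ≡ a

Idempotent : ∀ {n} → LatinSquare n → Set
Idempotent L = ∀ i → cell L i i ≡ i

Unipotent : ∀ {n} → LatinSquare n → Set
Unipotent {n} L = Σ (Fin n) λ s → ∀ i → cell L i i ≡ s

Isomorphic : ∀ {n} → LatinSquare n → LatinSquare n → Set
Isomorphic {n} L M =
  Σ (Fin n ↔ Fin n) λ α →
    ∀ r c → cell M (Inverse.to α r) (Inverse.to α c) ≡ Inverse.to α (cell L r c)

NumIsoClasses : (P : ∀ {n} → LatinSquare n → Set) → ℕ → ℕ → Set
NumIsoClasses P n k =
  Σ (Fin k → LatinSquare n) λ rep →
    (∀ i → P (rep i)) ×
    (∀ i j → Isomorphic (rep i) (rep j) → i ≡ j) ×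
    (∀ (L : LatinSquare n) → P L → ∃ λ i → Isomorphic L (rep i))

SemisymIdem : ∀ {n} → LatinSquare n → Set
SemisymIdem L = Semisymmetric L × Idempotent L

SemisymUni : ∀ {n} → LatinSquare n → Set
SemisymUni L = Semisymmetric L × Unipotent L

-- In a semisymmetric table (b (a b) = a) the triple (r , x , s) yields
-- (s , r , x), so such a table is automatically Latin. An idempotent
-- semisymmetric square of order n extends to a unipotent one of order n + 1
-- by adjoining a point 0 that is a two-sided identity and moving the diagonal
-- to 0. Conversely, once the diagonal symbol of a semisymmetric unipotent
-- square is relabelled 0, semisymmetry forces 0 to be an identity, and
-- deleting it (putting i back in cell (i , i)) recovers an idempotent square.
-- Isomorphisms of extensions fix the common diagonal symbol 0, so the
-- extension is a bijection on isomorphism classes. The number of classes of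
-- order n is finite because isomorphism is decidable and all tables of order n
-- can be listed.
module Submission where

open import Defs
open import Data.Nat using (ℕ; suc; _≤_; _^_)
open import Data.Fin using (Fin; zero; suc; finToFun; funToFin)
open import Data.Fin.Properties using (_≟_; suc-injective; 0≢1+n; any?; all?; finToFun-funToFin)
open import Data.Fin.Permutation
  using (Permutation′; _⟨$⟩ʳ_; _⟨$⟩ˡ_; inverseˡ; inverseʳ; permutation; flip; _∘ₚ_; transpose; remove; lift₀; lift₀-remove)
open import Data.List using (List; []; _∷_; length; lookup; map; allFin; deduplicate)
open import Data.List.Relation.Unary.Any using (Any; here; there)
import Data.List.Relation.Unary.Any as Any
open import Data.List.Relation.Unary.Any.Properties using (map⁺)
import Data.List.Relation.Unary.All as All
open import Data.List.Relation.Unary.AllPairs using (_∷_)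
open import Data.List.Membership.Propositional using (_∈_)
open import Data.List.Membership.Propositional.Properties using (∈-allFin; ∈-lookup)
import Data.List.Membership.Setoid as SetoidMembership
import Data.List.Relation.Unary.Unique.DecSetoid as DecSetoidUnique
open import Data.List.Relation.Unary.Unique.DecSetoid.Properties using (deduplicate-!)
open import Data.List.Relation.Unary.Enumerates.Setoid.Properties using (deduplicate⁺; lookup-surjective)
open import Data.Product using (Σ; ∃; _×_; _,_; proj₁; proj₂)
open import Function using (_∘_)
open import Function.Bundles using (Injection)
open import Function.Properties.Inverse using (↔⇒↣)
open import Level using (0ℓ)
open import Relation.Binary.Bundles using (DecSetoid)
import Relation.Binary.Construct.On as On
open import Relation.Nullary using (¬_; Dec; yes; no; contradiction)
open import Relation.Nullary.Decidable using (_×-dec_; map′)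
open import Relation.Unary using (Decidable)
open import Relation.Binary.PropositionalEquality using (_≡_; refl; sym; trans; cong; cong₂; module ≡-Reasoning)
open ≡-Reasoning

Table : ℕ → Set
Table n = Fin n → Fin n → Fin n

IsSemisymmetric : ∀ {n} → Table n → Set
IsSemisymmetric c = ∀ a b → c b (c a b) ≡ a

IsSemisymIdem : ∀ {n} → Table n → Set
IsSemisymIdem c = IsSemisymmetric c × (∀ i → c i i ≡ i)

module _ {n} {c : Table n} (ss : IsSemisymmetric c) where

  semisymmetric-rotate : ∀ a b → c (c a b) a ≡ b
  semisymmetric-rotate a b = begin
    c (c a b) a             ≡⟨ cong (c (c a b)) (ss a b) ⟨
    c (c a b) (c b (c a b)) ≡⟨ ss b (c a b) ⟩
    b                       ∎

  semisymmetric-rowInj : ∀ r {x y} → c r x ≡ c r y → x ≡ y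
  semisymmetric-rowInj r {x} {y} e = begin
    x           ≡⟨ semisymmetric-rotate r x ⟨
    c (c r x) r ≡⟨ cong (λ s → c s r) e ⟩
    c (c r y) r ≡⟨ semisymmetric-rotate r y ⟩
    y           ∎

  semisymmetric-colInj : ∀ k {x y} → c x k ≡ c y k → x ≡ y
  semisymmetric-colInj k {x} {y} e = begin
    x           ≡⟨ ss x k ⟨
    c k (c x k) ≡⟨ cong (c k) e ⟩
    c k (c y k) ≡⟨ ss y k ⟩
    y           ∎

fromSemisymmetric : ∀ {n} (c : Table n) → IsSemisymmetric c → LatinSquare n
fromSemisymmetric c ss = record
  { cell   = c
  ; rowInj = semisymmetric-rowInj ss
  ; colInj = semisymmetric-colInj ss
  }

IsSemisymIdem-resp : ∀ {n} {c d : Table n} → (∀ i j → c i j ≡ d i j) →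
                     IsSemisymIdem c → IsSemisymIdem d
IsSemisymIdem-resp {c = c} {d} c≗d (ss , idem) = ss′ , λ i → trans (sym (c≗d i i)) (idem i)
  where
  ss′ : IsSemisymmetric d
  ss′ a b = begin
    d b (d a b) ≡⟨ cong (d b) (c≗d a b) ⟨
    d b (c a b) ≡⟨ c≗d b (c a b) ⟨
    c b (c a b) ≡⟨ ss a b ⟩
    a           ∎

isSemisymIdem? : ∀ {n} (c : Table n) → Dec (IsSemisymIdem c)
isSemisymIdem? c = all? (λ a → all? λ b → c b (c a b) ≟ a) ×-dec all? (λ i → c i i ≟ i)

module _ {n : ℕ} where

  ≗⇒Isomorphic : {L M : LatinSquare n} → (∀ r c → cell L r c ≡ cell M r c) → Isomorphic L M
  ≗⇒Isomorphic L≗M = permutation (λ x → x) (λ x → x) (λ _ → refl) (λ _ → refl)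
                   , λ r c → sym (L≗M r c)

  Isomorphic-sym : {L M : LatinSquare n} → Isomorphic L M → Isomorphic M L
  Isomorphic-sym {L} {M} (α , hom) = flip α , λ r c → begin
    cell L (α ⟨$⟩ˡ r) (α ⟨$⟩ˡ c)                           ≡⟨ inverseˡ α ⟨
    α ⟨$⟩ˡ (α ⟨$⟩ʳ cell L (α ⟨$⟩ˡ r) (α ⟨$⟩ˡ c))          ≡⟨ cong (α ⟨$⟩ˡ_) (hom _ _) ⟨
    α ⟨$⟩ˡ cell M (α ⟨$⟩ʳ (α ⟨$⟩ˡ r)) (α ⟨$⟩ʳ (α ⟨$⟩ˡ c)) ≡⟨ cong (α ⟨$⟩ˡ_) (cong₂ (cell M) (inverseʳ α) (inverseʳ α)) ⟩
    α ⟨$⟩ˡ cell M r c                                       ∎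

  Isomorphic-trans : {L M N : LatinSquare n} → Isomorphic L M → Isomorphic M N → Isomorphic L N
  Isomorphic-trans {L} {M} {N} (α , homα) (β , homβ) = α ∘ₚ β , λ r c → begin
    cell N (β ⟨$⟩ʳ (α ⟨$⟩ʳ r)) (β ⟨$⟩ʳ (α ⟨$⟩ʳ c)) ≡⟨ homβ _ _ ⟩
    β ⟨$⟩ʳ cell M (α ⟨$⟩ʳ r) (α ⟨$⟩ʳ c)           ≡⟨ cong (β ⟨$⟩ʳ_) (homα r c) ⟩
    β ⟨$⟩ʳ (α ⟨$⟩ʳ cell L r c)                     ∎

  IsIsomorphism : LatinSquare n → LatinSquare n → (f g : Fin n → Fin n) → Set
  IsIsomorphism L M f g =
    (∀ x → f (g x) ≡ x) × (∀ x → g (f x) ≡ x) × (∀ r c → cell M (f r) (f c) ≡ f (cell L r c))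

  isIsomorphism? : ∀ L M f g → Dec (IsIsomorphism L M f g)
  isIsomorphism? L M f g =
    all? (λ x → f (g x) ≟ x) ×-dec all? (λ x → g (f x) ≟ x) ×-dec
    all? (λ r → all? λ c → cell M (f r) (f c) ≟ f (cell L r c))

  IsIsomorphism-resp : ∀ {L M f g f′ g′} → (∀ x → f x ≡ f′ x) → (∀ x → g x ≡ g′ x) →
                       IsIsomorphism L M f g → IsIsomorphism L M f′ g′
  IsIsomorphism-resp {L} {M} {f} {g} {f′} {g′} f≗f′ g≗g′ (fg , gf , hom) =
    (λ x → trans (sym (trans (f≗f′ (g x)) (cong f′ (g≗g′ x)))) (fg x)) ,
    (λ x → trans (sym (trans (g≗g′ (f x)) (cong g′ (f≗f′ x)))) (gf x)) ,
    (λ r c → begin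
      cell M (f′ r) (f′ c) ≡⟨ cong₂ (cell M) (f≗f′ r) (f≗f′ c) ⟨
      cell M (f r) (f c)   ≡⟨ hom r c ⟩
      f (cell L r c)       ≡⟨ f≗f′ _ ⟩
      f′ (cell L r c)      ∎)

  -- Functions Fin n → Fin n are coded by Fin (n ^ n), so the search for
  -- an isomorphism is a bounded search over pairs of codes.
  Isomorphic? : (L M : LatinSquare n) → Dec (Isomorphic L M)
  Isomorphic? L M =
    map′ fromCodes toCodes (any? λ u → any? λ v → isIsomorphism? L M (finToFun u) (finToFun v))
    where
    fromCodes : (∃ λ u → ∃ λ v → IsIsomorphism L M (finToFun u) (finToFun v)) → Isomorphic L M
    fromCodes (u , v , fg , gf , hom) = permutation (finToFun u) (finToFun v) fg gf , hom

    toCodes : Isomorphic L M → ∃ λ u → ∃ λ v → IsIsomorphism L M (finToFun u) (finToFun v)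
    toCodes (α , hom) =
      funToFin (α ⟨$⟩ʳ_) , funToFin (α ⟨$⟩ˡ_) ,
      IsIsomorphism-resp {L} {M} (λ x → sym (finToFun-funToFin (α ⟨$⟩ʳ_) x))
                         (λ x → sym (finToFun-funToFin (α ⟨$⟩ˡ_) x))
                         ((λ _ → inverseʳ α) , (λ _ → inverseˡ α) , hom)

Isomorphic-decSetoid : ℕ → DecSetoid 0ℓ 0ℓ
Isomorphic-decSetoid n = record
  { Carrier          = LatinSquare n
  ; _≈_              = Isomorphic
  ; isDecEquivalence = record
    { isEquivalence = record
      { refl  = λ {L} → ≗⇒Isomorphic {L = L} {L} (λ _ _ → refl)
      ; sym   = λ {L} {M} → Isomorphic-sym {L = L} {M}
      ; trans = λ {L} {M} {N} → Isomorphic-trans {L = L} {M} {N}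
      }
    ; _≟_ = Isomorphic?
    }
  }

module _ {a ℓ} (S : DecSetoid a ℓ) where
  open DecSetoid S using (Carrier; _≈_; setoid) renaming (sym to ≈-sym; _≟_ to _≈?_)
  open SetoidMembership setoid using () renaming (_∈_ to _∈ₛ_)
  open DecSetoidUnique S using (Unique)

  Unique-lookup-injective : ∀ {xs} → Unique xs → ∀ i j → lookup xs i ≈ lookup xs j → i ≡ j
  Unique-lookup-injective (_ ∷ _) zero zero _ = refl
  Unique-lookup-injective (x≉ ∷ _) zero (suc j) x≈ = contradiction x≈ (All.lookup x≉ (∈-lookup j))
  Unique-lookup-injective (x≉ ∷ _) (suc i) zero ≈x = contradiction (≈-sym ≈x) (All.lookup x≉ (∈-lookup i))
  Unique-lookup-injective (_ ∷ u) (suc i) (suc j) eq = cong suc (Unique-lookup-injective u i j eq)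

  enumeration⇒classRepresentatives : (xs : List Carrier) → (∀ x → x ∈ₛ xs) →
    Σ ℕ λ k → Σ (Fin k → Carrier) λ rep →
      (∀ i j → rep i ≈ rep j → i ≡ j) × (∀ x → ∃ λ i → x ≈ rep i)
  enumeration⇒classRepresentatives xs enum =
    length reps , lookup reps ,
    Unique-lookup-injective (deduplicate-! S xs) ,
    λ x → let i , lookup≈x = lookup-surjective setoid (deduplicate⁺ S enum) x
          in i , ≈-sym (lookup≈x refl)
    where
    reps : List Carrier
    reps = deduplicate _≈?_ xs

select : ∀ {A : Set} {P : A → Set} → Decidable P → List A → List (Σ A P)
select P? [] = []
select P? (x ∷ xs) with P? x
... | yes px = (x , px) ∷ select P? xs
... | no _   = select P? xs

select⁺ : ∀ {A : Set} {P : A → Set} (P? : Decidable P) {x xs} →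
          x ∈ xs → P x → Any (λ y → x ≡ proj₁ y) (select P? xs)
select⁺ P? {xs = y ∷ _} (here refl) px with P? y
... | yes _  = here refl
... | no ¬py = contradiction px ¬py
select⁺ P? {xs = y ∷ _} (there x∈) px with P? y
... | yes _ = there (select⁺ P? x∈ px)
... | no _  = select⁺ P? x∈ px

decodeTable : ∀ {n} → Fin ((n ^ n) ^ n) → Table n
decodeTable t i = finToFun (finToFun t i)

encodeTable : ∀ {n} → Table n → Fin ((n ^ n) ^ n)
encodeTable c = funToFin (λ i → funToFin (c i))

decode-encode : ∀ {n} (c : Table n) i j → decodeTable (encodeTable c) i j ≡ c i j
decode-encode c i j = trans (cong (λ f → finToFun f j) (finToFun-funToFin _ i))
                            (finToFun-funToFin (c i) j)

SemisymIdemSquare : ℕ → Set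
SemisymIdemSquare n = Σ (LatinSquare n) SemisymIdem

CodedSemisymIdem : ℕ → Set
CodedSemisymIdem n = Σ (Fin ((n ^ n) ^ n)) (IsSemisymIdem ∘ decodeTable {n})

decodeSquare : ∀ {n} → CodedSemisymIdem n → SemisymIdemSquare n
decodeSquare (t , ss , idem) = fromSemisymmetric (decodeTable t) ss , ss , idem

semisymIdemSquares : ∀ n → List (SemisymIdemSquare n)
semisymIdemSquares n = map decodeSquare (select (isSemisymIdem? ∘ decodeTable {n}) (allFin _))

semisymIdemSquares-complete : ∀ {n} (L : LatinSquare n) → SemisymIdem L →
  Any (λ y → Isomorphic L (proj₁ y)) (semisymIdemSquares n)
semisymIdemSquares-complete {n} L p =
  map⁺ (Any.map (λ { {t , q} refl → ≗⇒Isomorphic {L = L} {proj₁ (decodeSquare (t , q))} L≗decode })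
    (select⁺ (isSemisymIdem? ∘ decodeTable {n}) (∈-allFin (encodeTable (cell L)))
      (IsSemisymIdem-resp L≗decode p)))
  where
  L≗decode : ∀ i j → cell L i j ≡ decodeTable (encodeTable (cell L)) i j
  L≗decode i j = sym (decode-encode (cell L) i j)

semisymIdem-classes : ∀ n → ∃ λ k → NumIsoClasses SemisymIdem n k
semisymIdem-classes n
  with k , rep , rep-injective , rep-surjective ←
       enumeration⇒classRepresentatives (On.decSetoid (Isomorphic-decSetoid n) proj₁)
         (semisymIdemSquares n) (λ (L , p) → semisymIdemSquares-complete L p)
  = k , proj₁ ∘ rep , proj₂ ∘ rep , rep-injective , λ L p → rep-surjective (L , p)

extendTable : ∀ {n} → Table n → Table (suc n)
extendTable c zero    zero    = zero
extendTable c zero    (suc j) = suc j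
extendTable c (suc i) zero    = suc i
extendTable c (suc i) (suc j) with i ≟ j
... | yes _ = zero
... | no _  = suc (c i j)

module _ {n} (c : Table n) where

  extendTable-diagonal : ∀ x → extendTable c x x ≡ zero
  extendTable-diagonal zero = refl
  extendTable-diagonal (suc i) with i ≟ i
  ... | yes _  = refl
  ... | no i≢i = contradiction refl i≢i

  extendTable-≢ : ∀ {i j} → ¬ i ≡ j → extendTable c (suc i) (suc j) ≡ suc (c i j)
  extendTable-≢ {i} {j} i≢j with i ≟ j
  ... | yes i≡j = contradiction i≡j i≢j
  ... | no _    = refl

  extendTable-semisymmetric : IsSemisymIdem c → IsSemisymmetric (extendTable c)
  extendTable-semisymmetric _ zero    zero    = refl
  extendTable-semisymmetric _ zero    (suc j) = extendTable-diagonal (suc j)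
  extendTable-semisymmetric _ (suc i) zero    = refl
  extendTable-semisymmetric (ss , idem) (suc i) (suc j) with i ≟ j
  ... | yes refl = refl
  ... | no i≢j   = begin
    extendTable c (suc j) (suc (c i j)) ≡⟨ extendTable-≢ j≢cij ⟩
    suc (c j (c i j))                   ≡⟨ cong suc (ss i j) ⟩
    suc i                               ∎
    where
    j≢cij : ¬ j ≡ c i j
    j≢cij j≡cij = i≢j (begin
      i           ≡⟨ ss i j ⟨
      c j (c i j) ≡⟨ cong (c j) j≡cij ⟨
      c j j       ≡⟨ idem j ⟩
      j           ∎)

extend : ∀ {n} (L : LatinSquare n) → SemisymIdem L → LatinSquare (suc n)
extend L p = fromSemisymmetric (extendTable (cell L)) (extendTable-semisymmetric (cell L) p)

extend-SemisymUni : ∀ {n} (L : LatinSquare n) (p : SemisymIdem L) → SemisymUni (extend L p)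
extend-SemisymUni L p = extendTable-semisymmetric (cell L) p , zero , extendTable-diagonal (cell L)

⟨$⟩ʳ-injective : ∀ {n} (α : Permutation′ n) {x y} → α ⟨$⟩ʳ x ≡ α ⟨$⟩ʳ y → x ≡ y
⟨$⟩ʳ-injective α = Injection.injective (↔⇒↣ α)

module _ {n} (L L′ : LatinSquare n) (p : SemisymIdem L) (p′ : SemisymIdem L′) where

  extend-preserves-Isomorphic : Isomorphic L L′ → Isomorphic (extend L p) (extend L′ p′)
  extend-preserves-Isomorphic (α , hom) = lift₀ α , hom⁺
    where
    hom⁺ : ∀ r c → extendTable (cell L′) (lift₀ α ⟨$⟩ʳ r) (lift₀ α ⟨$⟩ʳ c)
                 ≡ lift₀ α ⟨$⟩ʳ extendTable (cell L) r c
    hom⁺ zero    zero    = refl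
    hom⁺ zero    (suc j) = refl
    hom⁺ (suc i) zero    = refl
    hom⁺ (suc i) (suc j) with i ≟ j
    ... | yes refl = extendTable-diagonal (cell L′) (suc (α ⟨$⟩ʳ i))
    ... | no i≢j   = trans (extendTable-≢ (cell L′) (i≢j ∘ ⟨$⟩ʳ-injective α)) (cong suc (hom i j))

  extend-reflects-Isomorphic : Isomorphic (extend L p) (extend L′ p′) → Isomorphic L L′
  extend-reflects-Isomorphic (α , hom) = β , homβ
    where
    α-fixes-zero : α ⟨$⟩ʳ zero ≡ zero
    α-fixes-zero = trans (sym (hom zero zero)) (extendTable-diagonal (cell L′) (α ⟨$⟩ʳ zero))

    β : Permutation′ n
    β = remove zero α

    suc-β : ∀ i → suc (β ⟨$⟩ʳ i) ≡ α ⟨$⟩ʳ suc i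
    suc-β i = lift₀-remove α α-fixes-zero (suc i)

    homβ : ∀ r c → cell L′ (β ⟨$⟩ʳ r) (β ⟨$⟩ʳ c) ≡ β ⟨$⟩ʳ cell L r c
    homβ r c with r ≟ c
    ... | yes refl = trans (proj₂ p′ _) (cong (β ⟨$⟩ʳ_) (sym (proj₂ p r)))
    ... | no r≢c   = suc-injective (begin
      suc (cell L′ (β ⟨$⟩ʳ r) (β ⟨$⟩ʳ c))                ≡⟨ extendTable-≢ (cell L′) βr≢βc ⟨
      extendTable (cell L′) (suc (β ⟨$⟩ʳ r)) (suc (β ⟨$⟩ʳ c)) ≡⟨ cong₂ (extendTable (cell L′)) (suc-β r) (suc-β c) ⟩
      extendTable (cell L′) (α ⟨$⟩ʳ suc r) (α ⟨$⟩ʳ suc c)     ≡⟨ hom (suc r) (suc c) ⟩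
      α ⟨$⟩ʳ extendTable (cell L) (suc r) (suc c)           ≡⟨ cong (α ⟨$⟩ʳ_) (extendTable-≢ (cell L) r≢c) ⟩
      α ⟨$⟩ʳ suc (cell L r c)                               ≡⟨ suc-β _ ⟨
      suc (β ⟨$⟩ʳ cell L r c)                               ∎)
      where
      βr≢βc : ¬ β ⟨$⟩ʳ r ≡ β ⟨$⟩ʳ c
      βr≢βc = r≢c ∘ ⟨$⟩ʳ-injective β

-- The default is only used on the diagonal, where it makes the restriction
-- idempotent.
predecessorOr : ∀ {n} → Fin n → Fin (suc n) → Fin n
predecessorOr i zero    = i
predecessorOr i (suc k) = k

module _ {n} (d : Table (suc n)) (ss : IsSemisymmetric d) (diagonal : ∀ x → d x x ≡ zero) where

  restrictTable : Table n
  restrictTable i j = predecessorOr i (d (suc i) (suc j))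

  zero-right-identity : ∀ x → d x zero ≡ x
  zero-right-identity x = trans (cong (d x) (sym (diagonal x))) (ss x x)

  zero-left-identity : ∀ x → d zero x ≡ x
  zero-left-identity x = trans (cong (d zero) (sym (zero-right-identity x))) (ss x zero)

  restrictTable-idempotent : ∀ i → restrictTable i i ≡ i
  restrictTable-idempotent i = cong (predecessorOr i) (diagonal (suc i))

  restrictTable-≢ : ∀ {i j} → ¬ i ≡ j → d (suc i) (suc j) ≡ suc (restrictTable i j)
  restrictTable-≢ {i} {j} i≢j with d (suc i) (suc j) in eq
  ... | zero  = contradiction (suc-injective (semisymmetric-rowInj {c = d} ss (suc i) d[i,i]≡d[i,j])) i≢j
    where
    d[i,i]≡d[i,j] : d (suc i) (suc i) ≡ d (suc i) (suc j)
    d[i,i]≡d[i,j] = trans (diagonal (suc i)) (sym eq)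
  ... | suc _ = refl

  extendTable-restrictTable : ∀ x y → extendTable restrictTable x y ≡ d x y
  extendTable-restrictTable zero    zero    = sym (diagonal zero)
  extendTable-restrictTable zero    (suc j) = sym (zero-left-identity (suc j))
  extendTable-restrictTable (suc i) zero    = sym (zero-right-identity (suc i))
  extendTable-restrictTable (suc i) (suc j) with i ≟ j
  ... | yes refl = sym (diagonal (suc i))
  ... | no i≢j   = sym (restrictTable-≢ i≢j)

  restrictTable-semisymmetric : IsSemisymmetric restrictTable
  restrictTable-semisymmetric a b with a ≟ b
  ... | yes refl = trans (cong (restrictTable a) (restrictTable-idempotent a)) (restrictTable-idempotent a)
  ... | no a≢b   = suc-injective (begin
    suc (restrictTable b (restrictTable a b)) ≡⟨ restrictTable-≢ b≢ab ⟨
    d (suc b) (suc (restrictTable a b))       ≡⟨ rotate ⟩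
    suc a                                     ∎)
    where
    rotate : d (suc b) (suc (restrictTable a b)) ≡ suc a
    rotate = trans (cong (d (suc b)) (sym (restrictTable-≢ a≢b))) (ss (suc a) (suc b))

    b≢ab : ¬ b ≡ restrictTable a b
    b≢ab b≡ab = 0≢1+n (begin
      zero                                ≡⟨ diagonal (suc b) ⟨
      d (suc b) (suc b)                   ≡⟨ cong (d (suc b) ∘ suc) b≡ab ⟩
      d (suc b) (suc (restrictTable a b)) ≡⟨ rotate ⟩
      suc a                               ∎)

conjugateTable : ∀ {n} → Permutation′ n → Table n → Table n
conjugateTable α c x y = α ⟨$⟩ʳ c (α ⟨$⟩ˡ x) (α ⟨$⟩ˡ y)

module _ {n} (α : Permutation′ n) (M : LatinSquare n) (ss : Semisymmetric M) where

  conjugateTable-semisymmetric : IsSemisymmetric (conjugateTable α (cell M))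
  conjugateTable-semisymmetric a b = begin
    α ⟨$⟩ʳ M′ (α ⟨$⟩ˡ b) (α ⟨$⟩ˡ (α ⟨$⟩ʳ M′ (α ⟨$⟩ˡ a) (α ⟨$⟩ˡ b))) ≡⟨ cong (λ x → α ⟨$⟩ʳ M′ (α ⟨$⟩ˡ b) x) (inverseˡ α) ⟩
    α ⟨$⟩ʳ M′ (α ⟨$⟩ˡ b) (M′ (α ⟨$⟩ˡ a) (α ⟨$⟩ˡ b))                ≡⟨ cong (α ⟨$⟩ʳ_) (ss _ _) ⟩
    α ⟨$⟩ʳ (α ⟨$⟩ˡ a)                                               ≡⟨ inverseʳ α ⟩
    a                                                                ∎
    where M′ = cell M

  conjugate : LatinSquare n
  conjugate = fromSemisymmetric (conjugateTable α (cell M)) conjugateTable-semisymmetric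

  Isomorphic-conjugate : Isomorphic M conjugate
  Isomorphic-conjugate = α , λ r c → cong (α ⟨$⟩ʳ_) (cong₂ (cell M) (inverseˡ α) (inverseˡ α))

transpose-sends : ∀ {n} (i j : Fin n) → transpose i j ⟨$⟩ʳ i ≡ j
transpose-sends i j with i ≟ i
... | yes _  = refl
... | no i≢i = contradiction refl i≢i

semisymUni⇒extension : ∀ {n} (M : LatinSquare (suc n)) → SemisymUni M →
  ∃ λ L → Σ (SemisymIdem L) λ p → Isomorphic M (extend L p)
semisymUni⇒extension {n} M (ss , s , diagonal) =
  L , p , Isomorphic-trans {L = M} {N} {extend L p} (Isomorphic-conjugate α M ss)
                             (≗⇒Isomorphic {L = N} {extend L p} N≗extension)
  where
  α : Permutation′ (suc n)
  α = transpose s zero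

  N : LatinSquare (suc n)
  N = conjugate α M ss

  ssN : IsSemisymmetric (cell N)
  ssN = conjugateTable-semisymmetric α M ss

  diagonalN : ∀ x → cell N x x ≡ zero
  diagonalN x = trans (cong (α ⟨$⟩ʳ_) (diagonal _)) (transpose-sends s zero)

  p : IsSemisymIdem (restrictTable (cell N) ssN diagonalN)
  p = restrictTable-semisymmetric (cell N) ssN diagonalN ,
      restrictTable-idempotent (cell N) ssN diagonalN

  L : LatinSquare n
  L = fromSemisymmetric (restrictTable (cell N) ssN diagonalN) (proj₁ p)

  N≗extension : ∀ x y → cell N x y ≡ extendTable (cell L) x y
  N≗extension x y = sym (extendTable-restrictTable (cell N) ssN diagonalN x y)

NumIsoClasses-transfer :
  ∀ {P Q : ∀ {n} → LatinSquare n → Set} {m n k}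
  (F : (L : LatinSquare m) → P L → LatinSquare n) →
  (∀ L p → Q (F L p)) →
  (∀ L L′ p p′ → Isomorphic L L′ → Isomorphic (F L p) (F L′ p′)) →
  (∀ L L′ p p′ → Isomorphic (F L p) (F L′ p′) → Isomorphic L L′) →
  (∀ M → Q M → ∃ λ L → Σ (P L) λ p → Isomorphic M (F L p)) →
  NumIsoClasses P m k → NumIsoClasses Q n k
NumIsoClasses-transfer F F-Q F-preserves F-reflects F-dense (rep , rep-P , rep-distinct , rep-covers) =
  (λ i → F (rep i) (rep-P i)) ,
  (λ i → F-Q (rep i) (rep-P i)) ,
  (λ i j F≅ → rep-distinct i j (F-reflects (rep i) (rep j) (rep-P i) (rep-P j) F≅)) ,
  λ M q →
    let L , p , M≅FL = F-dense M q
        i , L≅rep = rep-covers L p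
    in i , Isomorphic-trans {L = M} {F L p} {F (rep i) (rep-P i)}
                            M≅FL (F-preserves L (rep i) p (rep-P i) L≅rep)

theorem12 : ∀ (n : ℕ) → 1 ≤ n →
    ∃ λ k → NumIsoClasses SemisymIdem n k × NumIsoClasses SemisymUni (suc n) k
theorem12 n _ =
  let k , classes = semisymIdem-classes n
  in k , classes ,
     NumIsoClasses-transfer {P = SemisymIdem} {SemisymUni} extend extend-SemisymUni
       extend-preserves-Isomorphic extend-reflects-Isomorphic semisymUni⇒extension classes
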